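{- Let $\lambda\neq 0$ be real and let $r$ be a positive integer. For all integers $n,k\ge 0$, $$\frac{1}{k!}\sum_{m=0}^{k}\binom{k}{m}(-1)^{m}\sum_{\substack{0\le l_{1},\dots,l_{m}\le r-1\\ l_1+\cdots+l_m\le n}} \frac{n!\,(1)_{l_{1},\lambda} \cdots (1)_{l_{m},\lambda}\,(k-m)_{n-l_{1}-\cdots-l_{m},\lambda}}{l_{1}!\cdots l_{m}!\,(n-l_{1}-\cdots-l_{m})!} =\begin{cases} S_{2,\lambda}^{[r]}(n,kr), & \text{if } n\ge kr,\\ 0, & \text{if } 0\le n<kr,\end{cases}$$ where for $m=0$ the inner sum consists of the single term $(k)_{n,\lambda}$.
   Context: For real $x$ and nonzero real $\lambda$, the degenerate falling factorial is $(x)_{0,\lambda}=1$ and $(x)_{n,\lambda}=x(x-\lambda)(x-2\lambda)\cdots(x-(n-1)\lambda)$ for $n\ge1$. The degenerate exponential is $e_\lambda^x(t)=(1+\lambda t)^{x/\lambda}=\sum_{k\ge0}(x)_{k,\lambda}\frac{t^k}{k!}$, and $e_\lambda(t)=e_\lambda^1(t)$. For a positive integer $r$, the $r$-truncated degenerate Stirling numbers of the second kind $S_{2,\lambda}^{[r]}(n,kr)$ are defined (as formal power series in $t$) by $$\frac{1}{k!}\Big(e_{\lambda}(t)-\sum_{l=0}^{r-1}\frac{(1)_{l,\lambda}}{l!}t^{l}\Big)^{k}=\sum_{n=kr}^{\infty}S_{2,\lambda}^{[r]}(n,kr)\frac{t^{n}}{n!},\quad k\ge0.$$ -}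

module Defs where

open import Level using (Level)
open import Data.Nat as ℕ using (ℕ; zero; suc; _∸_; _≤?_)
open import Relation.Nullary using (yes; no)
open import Data.Nat.Combinatorics using (_C_)
import Data.Nat
open import Data.List as List using (List; []; _∷_; upTo; concatMap; filter; foldr)
open import Data.Vec as Vec using (Vec; []; _∷_)
open import Algebra.Bundles using (CommutativeRing; Semiring)

-- Everything is stated over a commutative ring R in which every positive
-- integer is invertible (i.e. a ℚ-algebra), e.g. R = ℝ.
-- `inv` supplies the inverse of (suc n) • 1 ; its specification is a
-- hypothesis of the theorem.
module Ops {c ℓ : Level} (R : CommutativeRing c ℓ)
           (inv : ℕ → CommutativeRing.Carrier R)
           (λ' : CommutativeRing.Carrier R) where

  open CommutativeRing R
  open import Algebra.Definitions.RawSemiring (Semiring.rawSemiring semiring) using (_×_; _^_)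

  nat : ℕ → Carrier
  nat n = n × 1#

  -- 1 / n  (only meaningful for n ≥ 1, which is the only way it is used)
  recip : ℕ → Carrier
  recip zero = 0#
  recip (suc n) = inv n

  falling : Carrier → ℕ → Carrier
  falling x zero = 1#
  falling x (suc n) = falling x n * (x - n × λ')

  sumTo : ℕ → (ℕ → Carrier) → Carrier
  sumTo zero f = f 0
  sumTo (suc n) f = sumTo n f + f (suc n)

  sumList : List Carrier → Carrier
  sumList = foldr _+_ 0#

  -- formal power series in t (ordinary coefficient sequences)
  Series : Set c
  Series = ℕ → Carrier

  oneS : Series
  oneS zero = 1#
  oneS (suc n) = 0#

  _⊛_ : Series → Series → Series
  (f ⊛ g) n = sumTo n (λ i → f i * g (n ∸ i))

  powS : Series → ℕ → Series
  powS f zero = oneS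
  powS f (suc k) = powS f k ⊛ f

  eλ : Series
  eλ k = falling 1# k * recip (k ℕ.!)

  truncE : ℕ → Series
  truncE r l with suc l ≤? r
  ... | yes _ = falling 1# l * recip (l ℕ.!)
  ... | no _ = 0#

  Fr : ℕ → Series
  Fr r l = eλ l - truncE r l

  -- S^{[r]}_{2,λ}(n, k r) : n! × [t^n] (1/k!) (e_λ(t) - Σ_{l<r} ...)^k
  S2 : (r n k : ℕ) → Carrier
  S2 r n k = nat (n ℕ.!) * (recip (k ℕ.!) * powS (Fr r) k n)

  tuples : (r m : ℕ) → List (Vec ℕ m)
  tuples r zero = [] ∷ []
  tuples r (suc m) = concatMap (λ l → List.map (l ∷_) (tuples r m)) (upTo r)

  boundedTuples : (r m n : ℕ) → List (Vec ℕ m)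
  boundedTuples r m n = filter (λ v → Vec.sum v ≤? n) (tuples r m)

  term : (n k m : ℕ) → Vec ℕ m → Carrier
  term n k m v =
    nat (n ℕ.!) * Vec.foldr _ (λ l acc → falling 1# l * acc) 1# v
      * falling (nat (k ∸ m)) (n ∸ Vec.sum v)
      * recip (Vec.foldr _ (λ l acc → (l ℕ.!) ℕ.* acc) 1 v ℕ.* ((n ∸ Vec.sum v) ℕ.!))

  innerSum : (r n k m : ℕ) → Carrier
  innerSum r n k m = sumList (List.map (term n k m) (boundedTuples r m n))

  LHS : (r n k : ℕ) → Carrier
  LHS r n k = recip (k ℕ.!) *
    sumTo k (λ m → nat (k C m) * ((- 1#) ^ m) * innerSum r n k m)

{-# OPTIONS --safe #-}
module Submission where

-- In the ring of formal power series, write T for the truncation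
-- Σ_{l<r} (1)_{l,λ} tˡ/l! of e_λ(t).  The binomial theorem gives
--   (e_λ(t) - T)^k = Σ_m (k choose m) (-1)^m T^m e_λ(t)^{k-m},
-- and the degenerate Vandermonde identity (x + y)_{n,λ} = Σ_i (n choose i) (x)_{i,λ} (y)_{n-i,λ}
-- turns e_λ(t)^{k-m} into e_λ^{k-m}(t).  Expanding T^m as a sum over tuples
-- (l₁,…,l_m) with lᵢ < r, the coefficient of tⁿ in T^m e_λ^{k-m}(t) is the inner
-- sum of the left-hand side divided by n!.  For n < kr both sides vanish because
-- e_λ(t) - T has order at least r.

open import Defs
open import Level using (Level)
open import Function using (_∘_)
open import Data.Nat as ℕ using (ℕ; zero; suc; _≤_; _<_; z≤n; s≤s; _∸_; _≤?_; _!)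
import Data.Nat.Properties as ℕₚ
open import Data.Nat.Combinatorics using (_C_)
import Data.Fin as Fin
open import Data.List as List using (List; []; _∷_; _++_)
import Data.List.Properties as Listₚ
open import Data.Vec as Vec using (Vec)
open import Data.Product using (_,_)
open import Data.Sum using (inj₁; inj₂)
open import Data.Empty using (⊥-elim)
open import Relation.Nullary using (Dec; yes; no; ¬_)
open import Relation.Binary.Structures using (IsEquivalence)
open import Relation.Binary.PropositionalEquality as ≡ using (_≡_)
open import Algebra.Bundles using (CommutativeRing; CommutativeSemiring; Semiring)
open import Algebra.Structures using (IsCommutativeMonoid)
open import Algebra.Structures.Biased using (IsCommutativeSemiringˡ)

module _ {c ℓ : Level} (R : CommutativeRing c ℓ)
         (inv : ℕ → CommutativeRing.Carrier R)
         (λ' : CommutativeRing.Carrier R) where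

  open CommutativeRing R hiding (zero)
  open Ops R inv λ'
  open import Algebra.Definitions.RawSemiring (Semiring.rawSemiring semiring) using (_×_; _^_)
  open import Algebra.Properties.Semiring.Mult semiring using (×-homo-+; ×1-homo-*)
  open import Algebra.Properties.CommutativeSemigroup +-commutativeSemigroup
    using () renaming (interchange to +-interchange)
  open import Algebra.Properties.CommutativeSemigroup *-commutativeSemigroup
    using () renaming (interchange to *-interchange; x∙yz≈y∙xz to *-left-comm)
  open import Algebra.Properties.AbelianGroup +-abelianGroup using (⁻¹-∙-comm)
  open import Algebra.Properties.Ring ring using (-1*x≈-x)
  open import Algebra.Solver.CommutativeMonoid *-commutativeMonoid using (solve; _⊜_; _⊕_)
  open import Relation.Binary.Reasoning.Setoid setoid

  sumTo-cong : ∀ n {f g : ℕ → Carrier} → (∀ i → i ≤ n → f i ≈ g i) → sumTo n f ≈ sumTo n g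
  sumTo-cong zero f≈g = f≈g 0 z≤n
  sumTo-cong (suc n) f≈g =
    +-cong (sumTo-cong n (λ i i≤n → f≈g i (ℕₚ.m≤n⇒m≤1+n i≤n))) (f≈g (suc n) ℕₚ.≤-refl)

  sumTo-zero : ∀ n {f : ℕ → Carrier} → (∀ i → i ≤ n → f i ≈ 0#) → sumTo n f ≈ 0#
  sumTo-zero n {f} f≈0 = trans (sumTo-cong n f≈0) (vanish n)
    where
    vanish : ∀ n → sumTo n (λ _ → 0#) ≈ 0#
    vanish zero = refl
    vanish (suc n) = trans (+-identityʳ _) (vanish n)

  sumTo-unfoldˡ : ∀ n (f : ℕ → Carrier) → sumTo (suc n) f ≈ f 0 + sumTo n (f ∘ suc)
  sumTo-unfoldˡ zero f = refl
  sumTo-unfoldˡ (suc n) f = trans (+-congʳ (sumTo-unfoldˡ n f)) (+-assoc _ _ _)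

  sumTo-+ : ∀ n (f g : ℕ → Carrier) → sumTo n (λ i → f i + g i) ≈ sumTo n f + sumTo n g
  sumTo-+ zero f g = refl
  sumTo-+ (suc n) f g = trans (+-congʳ (sumTo-+ n f g)) (+-interchange _ _ _ _)

  *-distribˡ-sumTo : ∀ n x (f : ℕ → Carrier) → x * sumTo n f ≈ sumTo n (λ i → x * f i)
  *-distribˡ-sumTo zero x f = refl
  *-distribˡ-sumTo (suc n) x f = trans (distribˡ _ _ _) (+-congʳ (*-distribˡ-sumTo n x f))

  *-distribʳ-sumTo : ∀ n x (f : ℕ → Carrier) → sumTo n f * x ≈ sumTo n (λ i → f i * x)
  *-distribʳ-sumTo zero x f = refl
  *-distribʳ-sumTo (suc n) x f = trans (distribʳ _ _ _) (+-congʳ (*-distribʳ-sumTo n x f))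

  sumTo-reverse : ∀ n (f : ℕ → Carrier) → sumTo n f ≈ sumTo n (λ i → f (n ∸ i))
  sumTo-reverse zero f = refl
  sumTo-reverse (suc n) f = begin
    sumTo n f + f (suc n)                  ≈⟨ +-congʳ (sumTo-reverse n f) ⟩
    sumTo n (λ i → f (n ∸ i)) + f (suc n)  ≈⟨ +-comm _ _ ⟩
    f (suc n) + sumTo n (λ i → f (n ∸ i))  ≈⟨ sumTo-unfoldˡ n (λ i → f (suc n ∸ i)) ⟨
    sumTo (suc n) (λ i → f (suc n ∸ i))    ∎

  sumTo-triangle : ∀ n (A : ℕ → ℕ → Carrier) →
    sumTo n (λ i → sumTo i (A i)) ≈ sumTo n (λ j → sumTo (n ∸ j) (λ p → A (j ℕ.+ p) j))
  sumTo-triangle zero A = refl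
  sumTo-triangle (suc n) A = begin
    sumTo n (λ i → sumTo i (A i)) + (sumTo n (A (suc n)) + A (suc n) (suc n))
      ≈⟨ +-congʳ (sumTo-triangle n A) ⟩
    Rows n + (sumTo n (A (suc n)) + A (suc n) (suc n))
      ≈⟨ +-assoc _ _ _ ⟨
    (Rows n + sumTo n (A (suc n))) + A (suc n) (suc n)
      ≈⟨ +-cong (sym (sumTo-+ n _ _)) (sym lastRow) ⟩
    sumTo n (λ j → Row n j + A (suc n) j) + Row (suc n) (suc n)
      ≈⟨ +-congʳ (sumTo-cong n extendRow) ⟩
    Rows (suc n) ∎
    where
    Row : ℕ → ℕ → Carrier
    Row n j = sumTo (n ∸ j) (λ p → A (j ℕ.+ p) j)
    Rows : ℕ → Carrier
    Rows n = sumTo n (Row n)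
    lastRow : Row (suc n) (suc n) ≈ A (suc n) (suc n)
    lastRow = trans (reflexive (≡.cong (λ m → sumTo m (λ p → A (suc n ℕ.+ p) (suc n))) (ℕₚ.n∸n≡0 n)))
                    (reflexive (≡.cong (λ m → A m (suc n)) (ℕₚ.+-identityʳ (suc n))))
    extendRow : ∀ j → j ≤ n → Row n j + A (suc n) j ≈ Row (suc n) j
    extendRow j j≤n = begin
      Row n j + A (suc n) j
        ≈⟨ +-congˡ (reflexive (≡.cong (λ m → A m j) j+[1+n∸j]≡1+n)) ⟨
      sumTo (suc (n ∸ j)) (λ p → A (j ℕ.+ p) j)
        ≡⟨ ≡.cong (λ m → sumTo m (λ p → A (j ℕ.+ p) j)) (ℕₚ.+-∸-assoc 1 j≤n) ⟨
      Row (suc n) j ∎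
      where
      j+[1+n∸j]≡1+n : j ℕ.+ suc (n ∸ j) ≡ suc n
      j+[1+n∸j]≡1+n = ≡.trans (ℕₚ.+-suc j (n ∸ j)) (≡.cong suc (ℕₚ.m+[n∸m]≡n j≤n))

  infix 4 _≋_
  infixl 6 _⊞_

  _≋_ : Series → Series → Set ℓ
  f ≋ g = ∀ n → f n ≈ g n

  _⊞_ : Series → Series → Series
  (f ⊞ g) n = f n + g n

  0S : Series
  0S _ = 0#

  negS : Series → Series
  negS f n = - f n

  ⊛-cong : ∀ {f f′ g g′} → f ≋ f′ → g ≋ g′ → f ⊛ g ≋ f′ ⊛ g′
  ⊛-cong f≋f′ g≋g′ n = sumTo-cong n (λ i _ → *-cong (f≋f′ i) (g≋g′ (n ∸ i)))

  ⊛-comm : ∀ f g → f ⊛ g ≋ g ⊛ f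
  ⊛-comm f g n = trans (sumTo-reverse n _) (sumTo-cong n (λ i i≤n →
    trans (*-comm _ _) (*-congʳ (reflexive (≡.cong g (ℕₚ.m∸[m∸n]≡n i≤n))))))

  ⊛-assoc : ∀ f g h → (f ⊛ g) ⊛ h ≋ f ⊛ (g ⊛ h)
  ⊛-assoc f g h n = begin
    sumTo n (λ i → sumTo i (λ j → f j * g (i ∸ j)) * h (n ∸ i))
      ≈⟨ sumTo-cong n (λ i _ → *-distribʳ-sumTo i _ _) ⟩
    sumTo n (λ i → sumTo i (λ j → (f j * g (i ∸ j)) * h (n ∸ i)))
      ≈⟨ sumTo-triangle n _ ⟩
    sumTo n (λ j → sumTo (n ∸ j) (λ p → (f j * g ((j ℕ.+ p) ∸ j)) * h (n ∸ (j ℕ.+ p))))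
      ≈⟨ sumTo-cong n (λ j _ → sumTo-cong (n ∸ j) (λ p _ →
           trans (*-cong (*-congˡ (reflexive (≡.cong g (ℕₚ.m+n∸m≡n j p))))
                         (reflexive (≡.cong h (≡.sym (ℕₚ.∸-+-assoc n j p)))))
                 (*-assoc _ _ _))) ⟩
    sumTo n (λ j → sumTo (n ∸ j) (λ p → f j * (g p * h ((n ∸ j) ∸ p))))
      ≈⟨ sumTo-cong n (λ j _ → *-distribˡ-sumTo (n ∸ j) _ _) ⟨
    sumTo n (λ j → f j * sumTo (n ∸ j) (λ p → g p * h ((n ∸ j) ∸ p))) ∎

  ⊛-distribʳ : ∀ f g h → (f ⊞ g) ⊛ h ≋ f ⊛ h ⊞ g ⊛ h
  ⊛-distribʳ f g h n = trans (sumTo-cong n (λ i _ → distribʳ _ _ _)) (sumTo-+ n _ _)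

  ⊛-zeroˡ : ∀ h → 0S ⊛ h ≋ 0S
  ⊛-zeroˡ h n = sumTo-zero n (λ i _ → zeroˡ _)

  ⊛-identityˡ : ∀ h → oneS ⊛ h ≋ h
  ⊛-identityˡ h zero = *-identityˡ _
  ⊛-identityˡ h (suc n) = begin
    sumTo (suc n) (λ i → oneS i * h (suc n ∸ i))
      ≈⟨ sumTo-unfoldˡ n _ ⟩
    1# * h (suc n) + sumTo n (λ i → 0# * h (n ∸ i))
      ≈⟨ +-cong (*-identityˡ _) (sumTo-zero n (λ i _ → zeroˡ _)) ⟩
    h (suc n) + 0#
      ≈⟨ +-identityʳ _ ⟩
    h (suc n) ∎

  ≋-isEquivalence : IsEquivalence _≋_
  ≋-isEquivalence = record
    { refl = λ n → refl ; sym = λ f≋g n → sym (f≋g n) ; trans = λ f≋g g≋h n → trans (f≋g n) (g≋h n) }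

  ⊞-isCommutativeMonoid : IsCommutativeMonoid _≋_ _⊞_ 0S
  ⊞-isCommutativeMonoid = record
    { isMonoid = record
      { isSemigroup = record
        { isMagma = record
          { isEquivalence = ≋-isEquivalence
          ; ∙-cong = λ f≋f′ g≋g′ n → +-cong (f≋f′ n) (g≋g′ n) }
        ; assoc = λ f g h n → +-assoc (f n) (g n) (h n) }
      ; identity = (λ f n → +-identityˡ (f n)) , (λ f n → +-identityʳ (f n)) }
    ; comm = λ f g n → +-comm (f n) (g n) }

  ⊛-isCommutativeMonoid : IsCommutativeMonoid _≋_ _⊛_ oneS
  ⊛-isCommutativeMonoid = record
    { isMonoid = record
      { isSemigroup = record
        { isMagma = record
          { isEquivalence = ≋-isEquivalence
          ; ∙-cong = ⊛-cong }
        ; assoc = ⊛-assoc }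
      ; identity = ⊛-identityˡ , (λ f n → trans (⊛-comm f oneS n) (⊛-identityˡ f n)) }
    ; comm = ⊛-comm }

  powerSeriesSemiring : CommutativeSemiring c ℓ
  powerSeriesSemiring = record
    { Carrier = Series ; _≈_ = _≋_ ; _+_ = _⊞_ ; _*_ = _⊛_ ; 0# = 0S ; 1# = oneS
    ; isCommutativeSemiring = IsCommutativeSemiringˡ.isCommutativeSemiring (record
      { +-isCommutativeMonoid = ⊞-isCommutativeMonoid
      ; *-isCommutativeMonoid = ⊛-isCommutativeMonoid
      ; distribʳ = λ h f g → ⊛-distribʳ f g h
      ; zeroˡ = ⊛-zeroˡ }) }

  open import Algebra.Definitions.RawSemiring (CommutativeSemiring.rawSemiring powerSeriesSemiring)
    using () renaming (_^_ to _^S_; _×_ to _×S_)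
  open import Algebra.Definitions.RawMonoid (CommutativeSemiring.+-rawMonoid powerSeriesSemiring)
    using () renaming (sum to sumS)

  ^S-cong : ∀ {f g} k → f ≋ g → f ^S k ≋ g ^S k
  ^S-cong zero f≋g n = refl
  ^S-cong (suc k) f≋g = ⊛-cong f≋g (^S-cong k f≋g)

  powS≋^S : ∀ f k → powS f k ≋ f ^S k
  powS≋^S f zero n = refl
  powS≋^S f (suc k) n = trans (⊛-cong {g = f} (powS≋^S f k) (λ _ → refl) n) (⊛-comm _ _ n)

  ×S-coefficient : ∀ m s n → (m ×S s) n ≈ nat m * s n
  ×S-coefficient zero s n = sym (zeroˡ _)
  ×S-coefficient (suc m) s n =
    trans (+-cong (sym (*-identityˡ _)) (×S-coefficient m s n)) (sym (distribʳ _ _ _))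

  sumS-coefficient : ∀ m (G : ℕ → Series) n → sumS {suc m} (G ∘ Fin.toℕ) n ≈ sumTo m (λ j → G j n)
  sumS-coefficient zero G n = +-identityʳ _
  sumS-coefficient (suc m) G n =
    trans (+-congˡ (sumS-coefficient m (G ∘ suc) n)) (sym (sumTo-unfoldˡ m _))

  scalar-⊛ : ∀ x (f g : Series) n → ((λ i → x * f i) ⊛ g) n ≈ x * (f ⊛ g) n
  scalar-⊛ x f g n = trans (sumTo-cong n (λ i _ → *-assoc _ _ _)) (sym (*-distribˡ-sumTo n _ _))

  negS-^S : ∀ f j → negS f ^S j ≋ (λ n → ((- 1#) ^ j) * (f ^S j) n)
  negS-^S f zero n = sym (*-identityˡ _)
  negS-^S f (suc j) n = begin
    sumTo n (λ i → - f i * (negS f ^S j) (n ∸ i))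
      ≈⟨ sumTo-cong n (λ i _ → *-cong (sym (-1*x≈-x _)) (negS-^S f j (n ∸ i))) ⟩
    sumTo n (λ i → (- 1# * f i) * (((- 1#) ^ j) * (f ^S j) (n ∸ i)))
      ≈⟨ sumTo-cong n (λ i _ → *-interchange _ _ _ _) ⟩
    sumTo n (λ i → (- 1# * ((- 1#) ^ j)) * (f i * (f ^S j) (n ∸ i)))
      ≈⟨ *-distribˡ-sumTo n _ _ ⟨
    (- 1# * ((- 1#) ^ j)) * (f ⊛ (f ^S j)) n ∎

  powS-vanishes-below : ∀ r f → (∀ l → l < r → f l ≈ 0#) → ∀ k n → n < k ℕ.* r → powS f k n ≈ 0#
  powS-vanishes-below r f f≈0 (suc k) n n<[1+k]r = sumTo-zero n factor≈0
    where
    factor≈0 : ∀ i → i ≤ n → powS f k i * f (n ∸ i) ≈ 0#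
    factor≈0 i i≤n with i ℕ.<? k ℕ.* r
    ... | yes i<kr = trans (*-congʳ (powS-vanishes-below r f f≈0 k i i<kr)) (zeroˡ _)
    ... | no i≮kr = trans (*-congˡ (f≈0 (n ∸ i) n∸i<r)) (zeroʳ _)
      where
      n∸i<r : n ∸ i < r
      n∸i<r = ≡.subst (n ∸ i <_) (ℕₚ.m+n∸n≡m r i)
        (ℕₚ.∸-monoˡ-< (ℕₚ.<-≤-trans n<[1+k]r (ℕₚ.+-monoʳ-≤ r (ℕₚ.≮⇒≥ i≮kr))) i≤n)

  when : ∀ {P : Set} → Dec P → Carrier → Carrier
  when (yes _) x = x
  when (no _) x = 0#

  when-cong : ∀ {P : Set} (P? : Dec P) {x y} → x ≈ y → when P? x ≈ when P? y
  when-cong (yes _) x≈y = x≈y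
  when-cong (no _) x≈y = refl

  when-*ˡ : ∀ {P : Set} (P? : Dec P) x y → when P? (x * y) ≈ x * when P? y
  when-*ˡ (yes _) x y = refl
  when-*ˡ (no _) x y = sym (zeroʳ x)

  sumList-cong : ∀ {A : Set} {f g : A → Carrier} xs → (∀ a → f a ≈ g a) →
    sumList (List.map f xs) ≈ sumList (List.map g xs)
  sumList-cong [] f≈g = refl
  sumList-cong (x ∷ xs) f≈g = +-cong (f≈g x) (sumList-cong xs f≈g)

  sumList-zero : ∀ {A : Set} {f : A → Carrier} xs → (∀ a → f a ≈ 0#) → sumList (List.map f xs) ≈ 0#
  sumList-zero [] f≈0 = refl
  sumList-zero (x ∷ xs) f≈0 = trans (+-cong (f≈0 x) (sumList-zero xs f≈0)) (+-identityʳ 0#)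

  *-distribˡ-sumList : ∀ {A : Set} (f : A → Carrier) x xs →
    x * sumList (List.map f xs) ≈ sumList (List.map (λ a → x * f a) xs)
  *-distribˡ-sumList f x [] = zeroʳ x
  *-distribˡ-sumList f x (y ∷ xs) = trans (distribˡ _ _ _) (+-congˡ (*-distribˡ-sumList f x xs))

  sumList-filter : ∀ {A : Set} {P : A → Set} (P? : ∀ a → Dec (P a)) (f : A → Carrier) xs →
    sumList (List.map f (List.filter P? xs)) ≈ sumList (List.map (λ a → when (P? a) (f a)) xs)
  sumList-filter P? f [] = refl
  sumList-filter P? f (x ∷ xs) with P? x
  ... | yes _ = +-congˡ (sumList-filter P? f xs)
  ... | no _ = trans (sumList-filter P? f xs) (sym (+-identityˡ _))

  sumList-++ : ∀ {A : Set} (f : A → Carrier) xs ys →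
    sumList (List.map f (xs ++ ys)) ≈ sumList (List.map f xs) + sumList (List.map f ys)
  sumList-++ f [] ys = sym (+-identityˡ _)
  sumList-++ f (x ∷ xs) ys = trans (+-congˡ (sumList-++ f xs ys)) (sym (+-assoc _ _ _))

  sumList-concatMap : ∀ {A B : Set} (G : A → List B) (f : B → Carrier) xs →
    sumList (List.map f (List.concatMap G xs)) ≈ sumList (List.map (λ a → sumList (List.map f (G a))) xs)
  sumList-concatMap G f [] = refl
  sumList-concatMap G f (x ∷ xs) = trans (sumList-++ f (G x) _) (+-congˡ (sumList-concatMap G f xs))

  sumBelow : ℕ → (ℕ → Carrier) → Carrier
  sumBelow zero f = 0#
  sumBelow (suc n) f = sumBelow n f + f n

  sumBelow-cong : ∀ n {f g : ℕ → Carrier} → (∀ i → i < n → f i ≈ g i) → sumBelow n f ≈ sumBelow n g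
  sumBelow-cong zero f≈g = refl
  sumBelow-cong (suc n) f≈g = +-cong (sumBelow-cong n (λ i i<n → f≈g i (ℕₚ.m≤n⇒m≤1+n i<n))) (f≈g n ℕₚ.≤-refl)

  sumBelow-unfoldˡ : ∀ n (f : ℕ → Carrier) → sumBelow (suc n) f ≈ f 0 + sumBelow n (f ∘ suc)
  sumBelow-unfoldˡ zero f = trans (+-identityˡ _) (sym (+-identityʳ _))
  sumBelow-unfoldˡ (suc n) f = trans (+-congʳ (sumBelow-unfoldˡ n f)) (+-assoc _ _ _)

  sumTo≈sumBelow : ∀ n (f : ℕ → Carrier) → sumTo n f ≈ sumBelow (suc n) f
  sumTo≈sumBelow zero f = sym (+-identityˡ _)
  sumTo≈sumBelow (suc n) f = +-congʳ (sumTo≈sumBelow n f)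

  sumBelow-truncate : ∀ m n (f : ℕ → Carrier) → n ≤ m → (∀ l → n ≤ l → l < m → f l ≈ 0#) →
    sumBelow m f ≈ sumBelow n f
  sumBelow-truncate zero .zero f z≤n f≈0 = refl
  sumBelow-truncate (suc m) n f n≤1+m f≈0 with ℕₚ.m≤n⇒m<n∨m≡n n≤1+m
  ... | inj₂ ≡.refl = refl
  ... | inj₁ (s≤s n≤m) = trans
    (+-cong (sumBelow-truncate m n f n≤m (λ l n≤l l<m → f≈0 l n≤l (ℕₚ.m≤n⇒m≤1+n l<m)))
            (f≈0 m n≤m ℕₚ.≤-refl))
    (+-identityʳ _)

  sumList-applyUpTo : ∀ n (h : ℕ → ℕ) (f : ℕ → Carrier) →
    sumList (List.map f (List.applyUpTo h n)) ≈ sumBelow n (f ∘ h)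
  sumList-applyUpTo zero h f = refl
  sumList-applyUpTo (suc n) h f =
    trans (+-congˡ (sumList-applyUpTo n (h ∘ suc) f)) (sym (sumBelow-unfoldˡ n _))

  sumBelow-when≈sumTo : ∀ r n (f : ℕ → Carrier) → (∀ l → r ≤ l → f l ≈ 0#) →
    sumBelow r (λ l → when (l ≤? n) (f l)) ≈ sumTo n f
  sumBelow-when≈sumTo r n f f≈0 = begin
    sumBelow r F
      ≈⟨ sumBelow-truncate (r ℕ.+ suc n) r F (ℕₚ.m≤m+n r (suc n)) (λ l r≤l _ → F≈0 l r≤l) ⟨
    sumBelow (r ℕ.+ suc n) F
      ≈⟨ sumBelow-truncate (r ℕ.+ suc n) (suc n) F (ℕₚ.m≤n+m (suc n) r) (λ l n<l _ → when-≰ l n<l) ⟩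
    sumBelow (suc n) F
      ≈⟨ sumBelow-cong (suc n) (λ l l<1+n → when-≤ l (ℕₚ.≤-pred l<1+n)) ⟩
    sumBelow (suc n) f
      ≈⟨ sumTo≈sumBelow n f ⟨
    sumTo n f ∎
    where
    F : ℕ → Carrier
    F l = when (l ≤? n) (f l)
    F≈0 : ∀ l → r ≤ l → F l ≈ 0#
    F≈0 l r≤l with l ≤? n
    ... | yes _ = f≈0 l r≤l
    ... | no _ = refl
    when-≰ : ∀ l → n < l → F l ≈ 0#
    when-≰ l n<l with l ≤? n
    ... | yes l≤n = ⊥-elim (ℕₚ.<⇒≱ n<l l≤n)
    ... | no _ = refl
    when-≤ : ∀ l → l ≤ n → F l ≈ f l
    when-≤ l l≤n with l ≤? n
    ... | yes _ = refl
    ... | no l≰n = ⊥-elim (l≰n l≤n)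

  module TupleExpansion (r : ℕ) (f g : Series)
                        (g≈f : ∀ l → l < r → g l ≈ f l)
                        (g≈0 : ∀ l → r ≤ l → g l ≈ 0#) where

    tupleProduct : ∀ {m} → Vec ℕ m → Carrier
    tupleProduct = Vec.foldr _ (λ l acc → f l * acc) 1#

    tupleTerm : ∀ m → ℕ → Series → Vec ℕ m → Carrier
    tupleTerm m n h v = when (Vec.sum v ≤? n) (tupleProduct v * h (n ∸ Vec.sum v))

    tupleSum : ℕ → ℕ → Series → Carrier
    tupleSum m n h = sumList (List.map (tupleTerm m n h) (tuples r m))

    tupleTerm-∷ : ∀ m n h l (w : Vec ℕ m) → l ≤ n →
      tupleTerm (suc m) n h (l Vec.∷ w) ≈ f l * tupleTerm m (n ∸ l) h w
    tupleTerm-∷ m n h l w l≤n with l ℕ.+ Vec.sum w ≤? n | Vec.sum w ≤? n ∸ l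
    ... | yes _ | yes _ =
      trans (*-assoc _ _ _) (*-congˡ (*-congˡ (reflexive (≡.cong h (≡.sym (ℕₚ.∸-+-assoc n l _))))))
    ... | yes l+s≤n | no s≰n∸l =
      ⊥-elim (s≰n∸l (≡.subst (_≤ n ∸ l) (ℕₚ.m+n∸m≡n l _) (ℕₚ.∸-monoˡ-≤ l l+s≤n)))
    ... | no l+s≰n | yes s≤n∸l =
      ⊥-elim (l+s≰n (≡.subst (l ℕ.+ Vec.sum w ≤_) (ℕₚ.m+[n∸m]≡n l≤n) (ℕₚ.+-monoʳ-≤ l s≤n∸l)))
    ... | no _ | no _ = sym (zeroʳ _)

    tupleTerm-∷-≰ : ∀ m n h l (w : Vec ℕ m) → ¬ (l ≤ n) → tupleTerm (suc m) n h (l Vec.∷ w) ≈ 0#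
    tupleTerm-∷-≰ m n h l w l≰n with l ℕ.+ Vec.sum w ≤? n
    ... | yes l+s≤n = ⊥-elim (l≰n (ℕₚ.m+n≤o⇒m≤o l l+s≤n))
    ... | no _ = refl

    tupleSum-∷ : ∀ m n h l →
      sumList (List.map (tupleTerm (suc m) n h ∘ (l Vec.∷_)) (tuples r m))
        ≈ when (l ≤? n) (f l * tupleSum m (n ∸ l) h)
    tupleSum-∷ m n h l with l ≤? n
    ... | yes l≤n = trans (sumList-cong (tuples r m) (λ w → tupleTerm-∷ m n h l w l≤n))
                          (sym (*-distribˡ-sumList _ (f l) (tuples r m)))
    ... | no l≰n = sumList-zero (tuples r m) (λ w → tupleTerm-∷-≰ m n h l w l≰n)

    tupleSum≈⊛ : ∀ m n h → tupleSum m n h ≈ ((g ^S m) ⊛ h) n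
    tupleSum≈⊛ zero n h = trans (+-identityʳ _) (trans (*-identityˡ _) (sym (⊛-identityˡ h n)))
    tupleSum≈⊛ (suc m) n h = begin
      sumList (List.map F (List.concatMap (λ l → List.map (l Vec.∷_) (tuples r m)) (List.upTo r)))
        ≈⟨ sumList-concatMap _ F (List.upTo r) ⟩
      sumList (List.map (λ l → sumList (List.map F (List.map (l Vec.∷_) (tuples r m)))) (List.upTo r))
        ≈⟨ sumList-applyUpTo r (λ l → l) _ ⟩
      sumBelow r (λ l → sumList (List.map F (List.map (l Vec.∷_) (tuples r m))))
        ≈⟨ sumBelow-cong r (λ l l<r → begin
             sumList (List.map F (List.map (l Vec.∷_) (tuples r m)))
               ≡⟨ ≡.cong sumList (Listₚ.map-∘ (tuples r m)) ⟨
             sumList (List.map (F ∘ (l Vec.∷_)) (tuples r m))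
               ≈⟨ tupleSum-∷ m n h l ⟩
             when (l ≤? n) (f l * tupleSum m (n ∸ l) h)
               ≈⟨ when-cong (l ≤? n) (*-cong (sym (g≈f l l<r)) (tupleSum≈⊛ m (n ∸ l) h)) ⟩
             when (l ≤? n) (g l * X (n ∸ l)) ∎) ⟩
      sumBelow r (λ l → when (l ≤? n) (g l * X (n ∸ l)))
        ≈⟨ sumBelow-when≈sumTo r n _ (λ l r≤l → trans (*-congʳ (g≈0 l r≤l)) (zeroˡ _)) ⟩
      (g ⊛ X) n
        ≈⟨ ⊛-assoc g (g ^S m) h n ⟨
      ((g ⊛ (g ^S m)) ⊛ h) n ∎
      where
      F = tupleTerm (suc m) n h
      X = (g ^S m) ⊛ h

  module _ (inv-spec : ∀ n → nat (suc n) * inv n ≈ 1#) where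

    nat-recip : ∀ a → 0 < a → nat a * recip a ≈ 1#
    nat-recip (suc a) _ = inv-spec a

    nat-cancelˡ : ∀ a {x y} → 0 < a → nat a * x ≈ nat a * y → x ≈ y
    nat-cancelˡ a {x} {y} 0<a ax≈ay = begin
      x                      ≈⟨ *-identityˡ x ⟨
      1# * x                 ≈⟨ *-congʳ recip-nat ⟨
      (recip a * nat a) * x  ≈⟨ *-assoc _ _ _ ⟩
      recip a * (nat a * x)  ≈⟨ *-congˡ ax≈ay ⟩
      recip a * (nat a * y)  ≈⟨ *-assoc _ _ _ ⟨
      (recip a * nat a) * y  ≈⟨ *-congʳ recip-nat ⟩
      1# * y                 ≈⟨ *-identityˡ y ⟩
      y                      ∎
      where
      recip-nat : recip a * nat a ≈ 1#
      recip-nat = trans (*-comm _ _) (nat-recip a 0<a)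

    recip-* : ∀ a b → 0 < a → 0 < b → recip (a ℕ.* b) ≈ recip a * recip b
    recip-* a b 0<a 0<b = nat-cancelˡ (a ℕ.* b) 0<ab (begin
      nat (a ℕ.* b) * recip (a ℕ.* b)        ≈⟨ nat-recip (a ℕ.* b) 0<ab ⟩
      1#                                     ≈⟨ *-identityˡ 1# ⟨
      1# * 1#                                ≈⟨ *-cong (nat-recip a 0<a) (nat-recip b 0<b) ⟨
      (nat a * recip a) * (nat b * recip b)  ≈⟨ *-interchange _ _ _ _ ⟩
      (nat a * nat b) * (recip a * recip b)  ≈⟨ *-congʳ (×1-homo-* a b) ⟨
      nat (a ℕ.* b) * (recip a * recip b)    ∎)
      where
      0<ab : 0 < a ℕ.* b
      0<ab = ℕₚ.*-mono-< 0<a 0<b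

    recip-1 : recip 1 ≈ 1#
    recip-1 = trans (sym (*-identityˡ _)) (trans (*-congʳ (sym (+-identityʳ 1#))) (inv-spec 0))

    degExp : Carrier → Series
    degExp x j = falling x j * recip (j !)

    degExp-0 : ∀ x → degExp x 0 ≈ 1#
    degExp-0 x = trans (*-identityˡ _) recip-1

    degExp-suc : ∀ x j → nat (suc j) * degExp x (suc j) ≈ (x - j × λ') * degExp x j
    degExp-suc x j = begin
      nat (suc j) * ((falling x j * (x - j × λ')) * recip (suc j ℕ.* j !))
        ≈⟨ *-congˡ (*-congˡ (recip-* (suc j) (j !) (s≤s z≤n) (ℕₚ.1≤n! j))) ⟩
      nat (suc j) * ((falling x j * (x - j × λ')) * (inv j * recip (j !)))
        ≈⟨ solve 5 (λ a F d i q → a ⊕ ((F ⊕ d) ⊕ (i ⊕ q)) ⊜ (a ⊕ i) ⊕ (d ⊕ (F ⊕ q))) refl _ _ _ _ _ ⟩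
      (nat (suc j) * inv j) * ((x - j × λ') * (falling x j * recip (j !)))
        ≈⟨ *-congʳ (inv-spec j) ⟩
      1# * ((x - j × λ') * degExp x j)
        ≈⟨ *-identityˡ _ ⟩
      (x - j × λ') * degExp x j ∎

    ⊛-degExp-weightˡ : ∀ x (h : Series) n →
      sumTo (suc n) (λ i → nat i * (degExp x i * h (suc n ∸ i)))
        ≈ sumTo n (λ j → (x - j × λ') * (degExp x j * h (n ∸ j)))
    ⊛-degExp-weightˡ x h n = begin
      sumTo (suc n) (λ i → nat i * (degExp x i * h (suc n ∸ i)))
        ≈⟨ sumTo-unfoldˡ n _ ⟩
      0# * (degExp x 0 * h (suc n)) + sumTo n (λ j → nat (suc j) * (degExp x (suc j) * h (n ∸ j)))
        ≈⟨ +-cong (zeroˡ _) (sumTo-cong n (λ j _ →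
             trans (sym (*-assoc _ _ _)) (trans (*-congʳ (degExp-suc x j)) (*-assoc _ _ _)))) ⟩
      0# + sumTo n (λ j → (x - j × λ') * (degExp x j * h (n ∸ j)))
        ≈⟨ +-identityˡ _ ⟩
      sumTo n (λ j → (x - j × λ') * (degExp x j * h (n ∸ j))) ∎

    ⊛-degExp-weightʳ : ∀ (h : Series) y n →
      sumTo (suc n) (λ i → nat (suc n ∸ i) * (h i * degExp y (suc n ∸ i)))
        ≈ sumTo n (λ j → (y - (n ∸ j) × λ') * (h j * degExp y (n ∸ j)))
    ⊛-degExp-weightʳ h y n = begin
      sumTo n (λ i → nat (suc n ∸ i) * (h i * degExp y (suc n ∸ i)))
        + nat (n ∸ n) * (h (suc n) * degExp y (n ∸ n))
        ≈⟨ +-cong (sumTo-cong n lowerRight) (trans (*-congʳ (reflexive (≡.cong nat (ℕₚ.n∸n≡0 n)))) (zeroˡ _)) ⟩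
      sumTo n (λ j → (y - (n ∸ j) × λ') * (h j * degExp y (n ∸ j))) + 0#
        ≈⟨ +-identityʳ _ ⟩
      sumTo n (λ j → (y - (n ∸ j) × λ') * (h j * degExp y (n ∸ j))) ∎
      where
      lowerRight : ∀ j → j ≤ n → nat (suc n ∸ j) * (h j * degExp y (suc n ∸ j))
                                  ≈ (y - (n ∸ j) × λ') * (h j * degExp y (n ∸ j))
      lowerRight j j≤n rewrite ℕₚ.+-∸-assoc 1 j≤n =
        trans (*-left-comm _ _ _) (trans (*-congˡ (degExp-suc y (n ∸ j))) (*-left-comm _ _ _))

    -- Split the weight n + 1 as i + (n + 1 - i); each part lowers the index of one
    -- factor through degExp-suc.
    degExp-⊛-suc : ∀ x y n →
      nat (suc n) * (degExp x ⊛ degExp y) (suc n) ≈ ((x + y) - n × λ') * (degExp x ⊛ degExp y) n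
    degExp-⊛-suc x y n = begin
      nat (suc n) * sumTo (suc n) G
        ≈⟨ *-distribˡ-sumTo (suc n) _ _ ⟩
      sumTo (suc n) (λ i → nat (suc n) * G i)
        ≈⟨ sumTo-cong (suc n) (λ i i≤1+n → trans (*-congʳ (split i i≤1+n)) (distribʳ _ _ _)) ⟩
      sumTo (suc n) (λ i → nat i * G i + nat (suc n ∸ i) * G i)
        ≈⟨ sumTo-+ (suc n) _ _ ⟩
      sumTo (suc n) (λ i → nat i * G i) + sumTo (suc n) (λ i → nat (suc n ∸ i) * G i)
        ≈⟨ +-cong (⊛-degExp-weightˡ x (degExp y) n) (⊛-degExp-weightʳ (degExp x) y n) ⟩
      sumTo n (λ j → (x - j × λ') * H j) + sumTo n (λ j → (y - (n ∸ j) × λ') * H j)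
        ≈⟨ sumTo-+ n _ _ ⟨
      sumTo n (λ j → (x - j × λ') * H j + (y - (n ∸ j) × λ') * H j)
        ≈⟨ sumTo-cong n (λ j j≤n → trans (sym (distribʳ _ _ _)) (*-congʳ (combine j j≤n))) ⟩
      sumTo n (λ j → ((x + y) - n × λ') * H j)
        ≈⟨ *-distribˡ-sumTo n _ _ ⟨
      ((x + y) - n × λ') * (degExp x ⊛ degExp y) n ∎
      where
      G H : ℕ → Carrier
      G i = degExp x i * degExp y (suc n ∸ i)
      H j = degExp x j * degExp y (n ∸ j)
      split : ∀ i → i ≤ suc n → nat (suc n) ≈ nat i + nat (suc n ∸ i)
      split i i≤1+n = trans (reflexive (≡.cong nat (≡.sym (ℕₚ.m+[n∸m]≡n i≤1+n)))) (×-homo-+ 1# i _)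
      combine : ∀ j → j ≤ n → (x - j × λ') + (y - (n ∸ j) × λ') ≈ (x + y) - n × λ'
      combine j j≤n = trans (+-interchange _ _ _ _) (+-congˡ (trans (⁻¹-∙-comm _ _) (-‿cong (begin
        j × λ' + (n ∸ j) × λ'  ≈⟨ ×-homo-+ λ' j (n ∸ j) ⟨
        (j ℕ.+ (n ∸ j)) × λ'   ≡⟨ ≡.cong (_× λ') (ℕₚ.m+[n∸m]≡n j≤n) ⟩
        n × λ'                 ∎))))

    degExp-⊛ : ∀ x y → degExp x ⊛ degExp y ≋ degExp (x + y)
    degExp-⊛ x y zero = trans (*-cong (degExp-0 x) (degExp-0 y)) (trans (*-identityˡ _) (sym (degExp-0 (x + y))))
    degExp-⊛ x y (suc n) = nat-cancelˡ (suc n) (s≤s z≤n)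
      (trans (degExp-⊛-suc x y n) (trans (*-congˡ (degExp-⊛ x y n)) (sym (degExp-suc (x + y) n))))

    degExp-zero≋oneS : degExp 0# ≋ oneS
    degExp-zero≋oneS zero = degExp-0 0#
    degExp-zero≋oneS (suc j) = trans (*-congʳ (falling-zero j)) (zeroˡ _)
      where
      falling-zero : ∀ j → falling 0# (suc j) ≈ 0#
      falling-zero zero = trans (*-identityˡ _) (-‿inverseʳ 0#)
      falling-zero (suc j) = trans (*-congʳ (falling-zero j)) (zeroˡ _)

    eλ-^S : ∀ a → eλ ^S a ≋ degExp (nat a)
    eλ-^S zero n = sym (degExp-zero≋oneS n)
    eλ-^S (suc a) n = trans (⊛-cong (λ _ → refl) (eλ-^S a) n) (degExp-⊛ 1# (nat a) n)

    import Algebra.Properties.CommutativeSemiring.Binomial powerSeriesSemiring as Binomial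

    binomial-expansion : ∀ (T : Series) k n →
      ((negS T ⊞ eλ) ^S k) n
        ≈ sumTo k (λ j → nat (k C j) * (((- 1#) ^ j) * ((T ^S j) ⊛ degExp (nat (k ∸ j))) n))
    binomial-expansion T k n = begin
      ((negS T ⊞ eλ) ^S k) n
        ≈⟨ Binomial.theorem k (negS T) eλ n ⟩
      Binomial.binomialExpansion (negS T) eλ k n
        ≈⟨ sumS-coefficient k (λ j → (k C j) ×S ((negS T ^S j) ⊛ (eλ ^S (k ∸ j)))) n ⟩
      sumTo k (λ j → ((k C j) ×S ((negS T ^S j) ⊛ (eλ ^S (k ∸ j)))) n)
        ≈⟨ sumTo-cong k (λ j _ → trans (×S-coefficient (k C j) _ n) (*-congˡ (
             trans (⊛-cong (negS-^S T j) (eλ-^S (k ∸ j)) n)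
                   (scalar-⊛ ((- 1#) ^ j) (T ^S j) (degExp (nat (k ∸ j))) n)))) ⟩
      sumTo k (λ j → nat (k C j) * (((- 1#) ^ j) * ((T ^S j) ⊛ degExp (nat (k ∸ j))) n)) ∎

    module _ (r : ℕ) where

      truncE-below : ∀ l → l < r → truncE r l ≈ eλ l
      truncE-below l l<r with suc l ≤? r
      ... | yes _ = refl
      ... | no l≮r = ⊥-elim (l≮r l<r)

      truncE-above : ∀ l → r ≤ l → truncE r l ≈ 0#
      truncE-above l r≤l with suc l ≤? r
      ... | yes l<r = ⊥-elim (ℕₚ.<⇒≱ l<r r≤l)
      ... | no _ = refl

      open TupleExpansion r eλ (truncE r) truncE-below truncE-above

      fallingProduct : ∀ {m} → Vec ℕ m → Carrier
      fallingProduct = Vec.foldr _ (λ l acc → falling 1# l * acc) 1#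

      factorialProduct : ∀ {m} → Vec ℕ m → ℕ
      factorialProduct = Vec.foldr _ (λ l acc → l ! ℕ.* acc) 1

      0<factorialProduct : ∀ {m} (v : Vec ℕ m) → 0 < factorialProduct v
      0<factorialProduct Vec.[] = s≤s z≤n
      0<factorialProduct (l Vec.∷ w) = ℕₚ.*-mono-< (ℕₚ.1≤n! l) (0<factorialProduct w)

      fallingProduct*recip≈tupleProduct : ∀ {m} (v : Vec ℕ m) →
        fallingProduct v * recip (factorialProduct v) ≈ tupleProduct v
      fallingProduct*recip≈tupleProduct Vec.[] = degExp-0 1#
      fallingProduct*recip≈tupleProduct (l Vec.∷ w) = begin
        (falling 1# l * fallingProduct w) * recip (l ! ℕ.* factorialProduct w)
          ≈⟨ *-congˡ (recip-* (l !) (factorialProduct w) (ℕₚ.1≤n! l) (0<factorialProduct w)) ⟩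
        (falling 1# l * fallingProduct w) * (recip (l !) * recip (factorialProduct w))
          ≈⟨ *-interchange _ _ _ _ ⟩
        eλ l * (fallingProduct w * recip (factorialProduct w))
          ≈⟨ *-congˡ (fallingProduct*recip≈tupleProduct w) ⟩
        eλ l * tupleProduct w ∎

      term≈factorial*tupleProduct : ∀ n k m (v : Vec ℕ m) →
        term n k m v ≈ nat (n !) * (tupleProduct v * degExp (nat (k ∸ m)) (n ∸ Vec.sum v))
      term≈factorial*tupleProduct n k m v = begin
        ((nat (n !) * fallingProduct v) * falling x d) * recip (factorialProduct v ℕ.* d !)
          ≈⟨ *-congˡ (recip-* (factorialProduct v) (d !) (0<factorialProduct v) (ℕₚ.1≤n! d)) ⟩
        ((nat (n !) * fallingProduct v) * falling x d) * (recip (factorialProduct v) * recip (d !))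
          ≈⟨ solve 5 (λ a F e i j → ((a ⊕ F) ⊕ e) ⊕ (i ⊕ j) ⊜ a ⊕ ((F ⊕ i) ⊕ (e ⊕ j))) refl _ _ _ _ _ ⟩
        nat (n !) * ((fallingProduct v * recip (factorialProduct v)) * degExp x d)
          ≈⟨ *-congˡ (*-congʳ (fallingProduct*recip≈tupleProduct v)) ⟩
        nat (n !) * (tupleProduct v * degExp x d) ∎
        where
        x = nat (k ∸ m)
        d = n ∸ Vec.sum v

      innerSum≈tupleSum : ∀ n k m → innerSum r n k m ≈ nat (n !) * tupleSum m n (degExp (nat (k ∸ m)))
      innerSum≈tupleSum n k m = begin
        sumList (List.map (term n k m) (List.filter (λ v → Vec.sum v ≤? n) (tuples r m)))
          ≈⟨ sumList-filter (λ v → Vec.sum v ≤? n) (term n k m) (tuples r m) ⟩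
        sumList (List.map (λ v → when (Vec.sum v ≤? n) (term n k m v)) (tuples r m))
          ≈⟨ sumList-cong (tuples r m) (λ v →
               trans (when-cong (Vec.sum v ≤? n) (term≈factorial*tupleProduct n k m v)) (when-*ˡ (Vec.sum v ≤? n) _ _)) ⟩
        sumList (List.map (λ v → nat (n !) * tupleTerm m n (degExp (nat (k ∸ m))) v) (tuples r m))
          ≈⟨ *-distribˡ-sumList _ _ (tuples r m) ⟨
        nat (n !) * tupleSum m n (degExp (nat (k ∸ m))) ∎

      LHS≈S2 : ∀ n k → LHS r n k ≈ S2 r n k
      LHS≈S2 n k = trans (*-congˡ alternatingSum≈) (*-left-comm _ _ _)
        where
        T = truncE r
        alternatingSum≈ : sumTo k (λ m → nat (k C m) * ((- 1#) ^ m) * innerSum r n k m)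
                            ≈ nat (n !) * powS (Fr r) k n
        alternatingSum≈ = begin
          sumTo k (λ m → nat (k C m) * ((- 1#) ^ m) * innerSum r n k m)
            ≈⟨ sumTo-cong k (λ m _ → trans
                 (*-congˡ (trans (innerSum≈tupleSum n k m) (*-congˡ (tupleSum≈⊛ m n (degExp (nat (k ∸ m)))))))
                 (solve 4 (λ a b N q → (a ⊕ b) ⊕ (N ⊕ q) ⊜ N ⊕ (a ⊕ (b ⊕ q))) refl _ _ _ _)) ⟩
          sumTo k (λ m → nat (n !) * (nat (k C m) * (((- 1#) ^ m) * ((T ^S m) ⊛ degExp (nat (k ∸ m))) n)))
            ≈⟨ *-distribˡ-sumTo k _ _ ⟨
          nat (n !) * sumTo k (λ m → nat (k C m) * (((- 1#) ^ m) * ((T ^S m) ⊛ degExp (nat (k ∸ m))) n))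
            ≈⟨ *-congˡ (binomial-expansion T k n) ⟨
          nat (n !) * ((negS T ⊞ eλ) ^S k) n
            ≈⟨ *-congˡ (trans (powS≋^S (Fr r) k n) (^S-cong k (λ l → +-comm _ _) n)) ⟨
          nat (n !) * powS (Fr r) k n ∎

      S2-vanishes : ∀ n k → n < k ℕ.* r → S2 r n k ≈ 0#
      S2-vanishes n k n<kr =
        trans (*-congˡ (trans (*-congˡ (powS-vanishes-below r (Fr r) Fr≈0 k n n<kr)) (zeroʳ _))) (zeroʳ _)
        where
        Fr≈0 : ∀ l → l < r → Fr r l ≈ 0#
        Fr≈0 l l<r = trans (+-congˡ (-‿cong (truncE-below l l<r))) (-‿inverseʳ _)

-- Imported only now: inside the module above, _*_ and _×_ are the ring's.
open import Data.Nat using (_*_)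
open import Data.Product using (_×_)

theorem2 : ∀ {c ℓ : Level} (R : CommutativeRing c ℓ)
    (inv : ℕ → CommutativeRing.Carrier R)
    (λ' : CommutativeRing.Carrier R) →
    let open CommutativeRing R renaming (_*_ to _·_) in
    let open Ops R inv λ' in
    (∀ (n : ℕ) → nat (suc n) · inv n ≈ 1#) →
    ¬ (λ' ≈ 0#) →
    (r : ℕ) → 1 ≤ r → (n k : ℕ) →
    (k * r ≤ n → LHS r n k ≈ S2 r n k) × (n < k * r → LHS r n k ≈ 0#)
-- The identity holds for every λ and r.
theorem2 R inv λ' inv-spec _ r _ n k =
  (λ _ → LHS≈S2 R inv λ' inv-spec r n k) ,
  (λ n<kr → trans (LHS≈S2 R inv λ' inv-spec r n k) (S2-vanishes R inv λ' inv-spec r n k n<kr))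
  where open CommutativeRing R using (trans)
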